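{- (1) If $t_1\le t_2$ in $\mathcal S$ and $t_1$ is total, then $t_2$ is total. (2) If $f,g:\mathcal S\to\mathcal S$ satisfy $f\le g$ pointwise and $f$ is total, then $g$ is total.
   Context: $\mathcal V$ is the domain of (possibly partial, possibly infinite) values of the Chariot language, equipped with the notion of totality defined in the author's earlier work (via priorities on constructors and destructors); it is known (from that earlier work) that every total element of $\mathcal V$ is maximal in $\mathcal V$. $\mathcal S$ is obtained from $\mathcal V$ by taking the Smyth power domain and adjoining a greatest element $0$ (the empty sum); its elements are formal sums $\sum_i u_i$ of elements of $\mathcal V$ (the summands), ordered by $\sum_i u_i\le\sum_j v_j$ iff for every $j$ there is $i$ with $u_i\le v_j$. An element $t\in\mathcal S$ is total if all its summands are total in $\mathcal V$ (so $0$ is total). A function $\mathcal S\to\mathcal S$ is total if it sends total elements to total elements. -}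

module Defs where

open import Level using (suc; zero)
open import Data.Product using (Σ; ∃; _×_; _,_)
open import Relation.Binary.PropositionalEquality using (_≡_)
open import Relation.Binary.Structures using (IsPartialOrder)

-- Abstract interface for the value domain 𝒱 of Chariot:
-- a partial order with a totality predicate such that every total
-- element is maximal (the fact imported from the author's earlier work).
record ValueDomain : Set₁ where
  field
    V         : Set
    _≤_       : V → V → Set
    isPO      : IsPartialOrder _≡_ _≤_
    TotalV    : V → Set
    total⇒max : ∀ {u v} → TotalV u → u ≤ v → u ≡ v

module SmythSums (𝒱 : ValueDomain) where
  open ValueDomain 𝒱

  -- An element of 𝒮: a formal sum Σ_{i ∈ Idx} summand i of elements of 𝒱.
  -- The empty index set gives the empty sum 0 (the adjoined top element).
  record S : Set₁ where
    constructor sum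
    field
      Idx     : Set
      summand : Idx → V
  open S public

  _≤S_ : S → S → Set
  t₁ ≤S t₂ = ∀ (j : Idx t₂) → Σ (Idx t₁) λ i → summand t₁ i ≤ summand t₂ j

  TotalS : S → Set
  TotalS t = ∀ (i : Idx t) → TotalV (summand t i)

  _≤F_ : (S → S) → (S → S) → Set₁
  f ≤F g = ∀ (t : S) → f t ≤S g t

  TotalF : (S → S) → Set₁
  TotalF f = ∀ (t : S) → TotalS t → TotalS (f t)

module Submission where

open import Defs
open import Data.Product using (_×_; _,_)
open import Relation.Binary.PropositionalEquality using (subst)

module _ (𝒱 : ValueDomain) where
  open ValueDomain 𝒱
  open SmythSums 𝒱

  TotalV-upward : ∀ {u v} → u ≤ v → TotalV u → TotalV v
  TotalV-upward u≤v total-u = subst TotalV (total⇒max total-u u≤v) total-u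

  TotalS-upward : ∀ (t₁ t₂ : S) → t₁ ≤S t₂ → TotalS t₁ → TotalS t₂
  TotalS-upward t₁ t₂ t₁≤t₂ total-t₁ j with t₁≤t₂ j
  ... | i , uᵢ≤vⱼ = TotalV-upward uᵢ≤vⱼ (total-t₁ i)

  TotalF-upward : ∀ (f g : S → S) → f ≤F g → TotalF f → TotalF g
  TotalF-upward f g f≤g total-f t total-t =
    TotalS-upward (f t) (g t) (f≤g t) (total-f t total-t)

mainTheorem9 : (𝒱 : ValueDomain) → let open SmythSums 𝒱 in
    (∀ (t₁ t₂ : S) → t₁ ≤S t₂ → TotalS t₁ → TotalS t₂)
    × (∀ (f g : S → S) → f ≤F g → TotalF f → TotalF g)
mainTheorem9 𝒱 = TotalS-upward 𝒱 , TotalF-upward 𝒱
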